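{- If $G$ is a tree, then $\dim(G)\le \dim(T(G))\le n_1(G)$, where $n_1(G)$ is the number of leaves (degree-one vertices) of $G$.
   Context: For a connected graph $H$, a set $S\subseteq V(H)$ is a resolving set if for every two distinct vertices $x,y$ there is $v\in S$ with $d_H(x,v)\ne d_H(y,v)$; $\dim(H)$ is the minimum cardinality of a resolving set. The total graph $T(G)$ has vertex set $V(G)\cup\{v_e: e\in E(G)\}$, and its edges are: all edges of $G$; the edges $xv_e$ for each $e\in E(G)$ and each endvertex $x$ of $e$; and the edges $v_ev_f$ for distinct edges $e,f$ of $G$ sharing an endvertex. -}

module Defs where

open import Data.Nat using (ℕ; zero; suc; _+_; _∸_; _≤_; _<_)
open import Data.Fin using (Fin; _↑ˡ_; _↑ʳ_)
open import Data.Fin.Properties using () renaming (_≟_ to _≟ᶠ_)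
open import Data.Fin.Subset using (Subset; _∈_; ∣_∣)
open import Data.Nat.Properties using () renaming (_≟_ to _≟ℕ_)
open import Data.List using (length; filter; allFin)
open import Data.Product using (Σ; ∃; ∃-syntax; _×_; _,_; proj₁; proj₂)
open import Data.Sum using (_⊎_)
open import Relation.Nullary using (¬_)
open import Relation.Nullary.Decidable using (_⊎-dec_)
open import Relation.Binary.PropositionalEquality using (_≡_; _≢_)

record Graph : Set₁ where
  field
    order : ℕ
    Adj   : Fin order → Fin order → Set

module _ (H : Graph) where
  open Graph H

  data Walk : Fin order → Fin order → ℕ → Set where
    here : ∀ {x} → Walk x x zero
    step : ∀ {x y z k} → Adj x y → Walk y z k → Walk x z (suc k)

  Dist : Fin order → Fin order → ℕ → Set
  Dist x y k = Walk x y k × (∀ l → Walk x y l → k ≤ l)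

  Connected : Set
  Connected = ∀ x y → ∃[ k ] Walk x y k

  Resolving : Subset order → Set
  Resolving S = ∀ x y → x ≢ y →
    ∃[ v ] (v ∈ S × ∃[ k ] ∃[ l ] (Dist x v k × Dist y v l × k ≢ l))

  IsMetricDim : ℕ → Set
  IsMetricDim d = (∃[ S ] (Resolving S × ∣ S ∣ ≡ d))
                × (∀ S → Resolving S → d ≤ ∣ S ∣)

record SimpleGraph : Set where
  field
    n    : ℕ
    m    : ℕ
    ends : Fin m → Fin n × Fin n
    loopless : ∀ e → proj₁ (ends e) ≢ proj₂ (ends e)
    noMulti  : ∀ e f →
      (ends e ≡ ends f ⊎ ends e ≡ (proj₂ (ends f) , proj₁ (ends f))) → e ≡ f

module _ (G : SimpleGraph) where
  open SimpleGraph G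

  Incident : Fin n → Fin m → Set
  Incident x e = proj₁ (ends e) ≡ x ⊎ proj₂ (ends e) ≡ x

  SAdj : Fin n → Fin n → Set
  SAdj x y = ∃[ e ] (ends e ≡ (x , y) ⊎ ends e ≡ (y , x))

  toGraph : Graph
  toGraph = record { order = n ; Adj = SAdj }

  HasCycle : Set
  HasCycle = ∃[ k ] (3 ≤ k × Σ (ℕ → Fin n) λ f →
      (∀ i j → i < k → j < k → f i ≡ f j → i ≡ j)
    × (∀ i → suc i < k → SAdj (f i) (f (suc i)))
    × SAdj (f (k ∸ 1)) (f 0))

  IsTree : Set
  IsTree = 1 ≤ n × Connected toGraph × ¬ HasCycle

  degree : Fin n → ℕ
  degree x = length (filter (λ e → (proj₁ (ends e) ≟ᶠ x) ⊎-dec (proj₂ (ends e) ≟ᶠ x)) (allFin m))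

  leaves : ℕ
  leaves = length (filter (λ x → degree x ≟ℕ 1) (allFin n))

  -- the total graph T(G) on vertex set Fin (n + m):
  -- x ↑ˡ m is the vertex x of G, n ↑ʳ e is the vertex v_e
  data TAdj : Fin (n + m) → Fin (n + m) → Set where
    vv : ∀ {x y} → SAdj x y → TAdj (x ↑ˡ m) (y ↑ˡ m)
    ve : ∀ {x e} → Incident x e → TAdj (x ↑ˡ m) (n ↑ʳ e)
    ev : ∀ {x e} → Incident x e → TAdj (n ↑ʳ e) (x ↑ˡ m)
    ee : ∀ {x e f} → e ≢ f → Incident x e → Incident x f → TAdj (n ↑ʳ e) (n ↑ʳ f)

  totalGraph : Graph
  totalGraph = record { order = n + m ; Adj = TAdj }

{-# OPTIONS --safe #-}
-- For distinct vertices u, w of a tree, walking from u away from w until no step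
-- increases the distance to w ends in a leaf ℓ with d(u,ℓ) + d(u,w) ≤ d(w,ℓ).  As the distance
-- in T(G) from v_e to ℓ is one more than the distance from the nearer end of e, such leaves
-- separate any two vertices of T(G), so the leaves resolve T(G).
--
-- Root the tree at ρ and send each v_e to the end of e farther from ρ.  If v_e
-- separates x and y but that end does not, then x and y lie on opposite sides of e, and every
-- vertex on the side of ρ separates them.  So the image of a resolving set S of T(G) resolves G
-- once every v_e ∈ S has an image point on its ρ-side: root at a vertex of S, or else at the
-- end of one edge of S facing another one (a lone v_e cannot separate the two ends of e).
--
-- Acyclicity enters through one fact: two geodesics from w, of lengths k ≤ k' ≤ k + 1, with
-- adjacent ends and different vertices at distance k from w would close up into a cycle.
module Submission where

open import Defs
open import Data.Nat using (ℕ; zero; suc; _+_; _∸_; _≤_; _<_; _⊓_; z≤n; s≤s; z<s; _≤?_; _<?_)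
open import Data.Nat.Properties
open import Data.Nat.Induction using (<-rec)
open import Data.Fin using (Fin; zero; suc; toℕ; _↑ˡ_; _↑ʳ_; splitAt; fromℕ<)
open import Data.Fin.Properties as FinP
  using (any?; pigeonhole; toℕ<n; splitAt-↑ˡ; splitAt-↑ʳ; ↑ˡ-injective) renaming (_≟_ to _≟ᶠ_)
open import Data.Fin.Subset using (Subset; _∈_; ∣_∣; ⁅_⁆; _∪_; inside; outside) renaming (⊥ to ∅)
open import Data.Fin.Subset.Properties using (x∈⁅x⁆; x∈p∪q⁺; ∣⁅x⁆∣≡1; ∣⊥∣≡0; _∈?_)
open import Data.List using (length; filter; tabulate)
open import Data.List.Properties using (filter-none; filter-some)
import Data.List.Relation.Unary.Any.Properties as Any
import Data.List.Relation.Unary.All.Properties as All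
import Data.Vec as Vec
open import Data.Vec.Properties using (lookup⇒[]=; lookup∘tabulate)
open import Data.Vec using (_∷_; []; here; there)
open import Data.Product as Prod using (∃-syntax; _×_; _,_; proj₁; proj₂)
open import Data.Product.Properties using (≡-dec; ,-injective)
open import Data.Sum as Sum using (_⊎_; inj₁; inj₂; [_,_]′)
open import Data.Empty using (⊥-elim)
open import Relation.Nullary using (¬_; Dec; yes; no; does; contradiction)
open import Relation.Nullary.Decidable using (_×-dec_; _⊎-dec_; toSum; dec-true)
open import Level using (0ℓ)
open import Relation.Unary using (Pred) renaming (Decidable to Decidable₁)
open import Relation.Binary.Definitions using (Symmetric; Decidable; DecidableEquality; tri<; tri≈; tri>)
open import Relation.Binary.PropositionalEquality

least-witness : {P : Pred ℕ 0ℓ} → Decidable₁ P →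
                ∀ {k} → P k → ∃[ j ] (P j × (∀ {i} → i < j → ¬ P i))
least-witness {P} P? {k} = <-rec Minimal search k
  where
    Minimal : ℕ → Set
    Minimal k = P k → ∃[ j ] (P j × (∀ {i} → i < j → ¬ P i))
    search : ∀ k → (∀ {i} → i < k → Minimal i) → Minimal k
    search k below pk with anyUpTo? P? k
    ... | yes (i , i<k , pi) = below i<k pi
    ... | no none            = k , pk , λ i<k pi → none (_ , i<k , pi)

last-agreement : {A : Set} → DecidableEquality A → (P Q : ℕ → A) → P 0 ≡ Q 0 → ∀ K →
                 ∃[ j ] (j ≤ K × P j ≡ Q j × (∀ {i} → j < i → i ≤ K → P i ≢ Q i))
last-agreement _≟_ P Q P₀≡Q₀ zero = 0 , z≤n , P₀≡Q₀ , λ 0<i i≤0 → contradiction (≤-trans 0<i i≤0) λ ()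
last-agreement _≟_ P Q P₀≡Q₀ (suc K) with P (suc K) ≟ Q (suc K)
... | yes agree = suc K , ≤-refl , agree , λ K<i i≤K → contradiction (≤-trans K<i i≤K) (<-irrefl refl)
... | no  differ with j , j≤K , agree , apart ← last-agreement _≟_ P Q P₀≡Q₀ K =
  j , m≤n⇒m≤1+n j≤K , agree , apart′
  where
    apart′ : ∀ {i} → j < i → i ≤ suc K → P i ≢ Q i
    apart′ j<i i≤1+K with m≤n⇒m<n∨m≡n i≤1+K
    ... | inj₁ i<1+K = apart j<i (≤-pred i<1+K)
    ... | inj₂ refl  = differ

module _ {A : Set} {P : Pred A 0ℓ} (P? : Decidable₁ P) where

  count-tabulate-≤1 : ∀ {k} (f : Fin k → A) → (∀ {i j} → P (f i) → P (f j) → i ≡ j) →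
                      length (filter P? (tabulate f)) ≤ 1
  count-tabulate-≤1 {zero}  f unique = z≤n
  count-tabulate-≤1 {suc k} f unique with P? (f zero)
  ... | yes p = s≤s (≤-reflexive (cong length
                  (filter-none P? (All.tabulate⁺ λ i q → FinP.0≢1+n (unique {j = suc i} p q)))))
  ... | no  _ = count-tabulate-≤1 (λ i → f (suc i))
                  (λ {i} {j} p q → FinP.suc-injective (unique {suc i} {suc j} p q))

  count-tabulate : ∀ {k} (f : Fin k → A) →
                   ∣ Vec.tabulate (λ i → does (P? (f i))) ∣ ≡ length (filter P? (tabulate f))
  count-tabulate {zero}  f = refl
  count-tabulate {suc k} f with P? (f zero)
  ... | yes _ = cong suc (count-tabulate (λ i → f (suc i)))
  ... | no  _ = count-tabulate (λ i → f (suc i))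

data SumView (n m : ℕ) : Fin (n + m) → Set where
  inˡ : ∀ x → SumView n m (x ↑ˡ m)
  inʳ : ∀ e → SumView n m (n ↑ʳ e)

sumView : ∀ n m t → SumView n m t
sumView zero    m t       = inʳ t
sumView (suc n) m zero    = inˡ zero
sumView (suc n) m (suc t) with sumView n m t
... | inˡ x = inˡ (suc x)
... | inʳ e = inʳ e

∣p∪q∣≤∣p∣+∣q∣ : ∀ {N} (p q : Subset N) → ∣ p ∪ q ∣ ≤ ∣ p ∣ + ∣ q ∣
∣p∪q∣≤∣p∣+∣q∣ []            []            = z≤n
∣p∪q∣≤∣p∣+∣q∣ (inside  ∷ p) (inside  ∷ q) = s≤s (≤-trans (∣p∪q∣≤∣p∣+∣q∣ p q) (+-monoʳ-≤ ∣ p ∣ (n≤1+n _)))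
∣p∪q∣≤∣p∣+∣q∣ (inside  ∷ p) (outside ∷ q) = s≤s (∣p∪q∣≤∣p∣+∣q∣ p q)
∣p∪q∣≤∣p∣+∣q∣ (outside ∷ p) (inside  ∷ q) = subst (suc ∣ p ∪ q ∣ ≤_) (sym (+-suc ∣ p ∣ ∣ q ∣)) (s≤s (∣p∪q∣≤∣p∣+∣q∣ p q))
∣p∪q∣≤∣p∣+∣q∣ (outside ∷ p) (outside ∷ q) = ∣p∪q∣≤∣p∣+∣q∣ p q

image : ∀ {N M} → Subset N → (Fin N → Fin M) → Subset M
image []            φ = ∅
image (inside  ∷ S) φ = ⁅ φ zero ⁆ ∪ image S (λ i → φ (suc i))
image (outside ∷ S) φ = image S (λ i → φ (suc i))

∣image∣≤ : ∀ {N M} (S : Subset N) (φ : Fin N → Fin M) → ∣ image S φ ∣ ≤ ∣ S ∣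
∣image∣≤ {M = M} [] φ = ≤-reflexive (∣⊥∣≡0 M)
∣image∣≤ (inside  ∷ S) φ = ≤-trans (∣p∪q∣≤∣p∣+∣q∣ ⁅ φ zero ⁆ (image S φ′))
  (subst (λ s → s + ∣ image S φ′ ∣ ≤ suc ∣ S ∣) (sym (∣⁅x⁆∣≡1 (φ zero))) (s≤s (∣image∣≤ S φ′)))
  where φ′ = λ i → φ (suc i)
∣image∣≤ (outside ∷ S) φ = ∣image∣≤ S (λ i → φ (suc i))

∈image : ∀ {N M} (S : Subset N) (φ : Fin N → Fin M) {i} → i ∈ S → φ i ∈ image S φ
∈image (inside  ∷ S) φ here      = x∈p∪q⁺ (inj₁ (x∈⁅x⁆ (φ zero)))
∈image (inside  ∷ S) φ (there i) = x∈p∪q⁺ (inj₂ (∈image S (λ i → φ (suc i)) i))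
∈image (outside ∷ S) φ (there i) = ∈image S (λ i → φ (suc i)) i

module _ {H : Graph} where
  open Graph H

  private variable
    x y z : Fin order
    k l : ℕ

  infixr 5 _++ʷ_
  infixl 5 _∷ʳʷ_

  _++ʷ_ : Walk H x y k → Walk H y z l → Walk H x z (k + l)
  here     ++ʷ q = q
  step a p ++ʷ q = step a (p ++ʷ q)

  _∷ʳʷ_ : Walk H x y k → Adj y z → Walk H x z (suc k)
  here     ∷ʳʷ a = step a here
  step b p ∷ʳʷ a = step b (p ∷ʳʷ a)

  unsnocʷ : Walk H x z (suc k) → ∃[ y ] (Walk H x y k × Adj y z)
  unsnocʷ (step a here)       = _ , here , a
  unsnocʷ (step a (step b p)) with y , q , c ← unsnocʷ (step b p) = y , step a q , c

  Walk₀⇒≡ : Walk H x y 0 → x ≡ y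
  Walk₀⇒≡ here = refl

  Dist-unique : Dist H x y k → Dist H x y l → k ≡ l
  Dist-unique (p , p-min) (q , q-min) = ≤-antisym (p-min _ q) (q-min _ p)

  walk-lipschitz : (f : Fin order → ℕ) → (∀ {s t} → Adj s t → f s ≤ suc (f t)) →
                   Walk H x y k → f x ≤ k + f y
  walk-lipschitz f lip here       = ≤-refl
  walk-lipschitz f lip (step a p) = ≤-trans (lip a) (s≤s (walk-lipschitz f lip p))

  at : Walk H x y k → ℕ → Fin order
  at {x} here       i       = x
  at {x} (step _ p) zero    = x
  at     (step _ p) (suc i) = at p i

  at-start : (p : Walk H x y k) → at p 0 ≡ x
  at-start here       = refl
  at-start (step _ _) = refl

  at-end : (p : Walk H x y k) → at p k ≡ y
  at-end here       = refl
  at-end (step _ p) = at-end p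

  at-adjacent : (p : Walk H x y k) → ∀ i → suc i ≤ k → Adj (at p i) (at p (suc i))
  at-adjacent (step a p) zero    _         = subst (Adj _) (sym (at-start p)) a
  at-adjacent (step a p) (suc i) (s≤s i<k) = at-adjacent p i i<k

  at-∷ʳʷ : (p : Walk H x y k) (a : Adj y z) → ∀ i → i ≤ k → at (p ∷ʳʷ a) i ≡ at p i
  at-∷ʳʷ here       a zero    _         = refl
  at-∷ʳʷ (step b p) a zero    _         = refl
  at-∷ʳʷ (step b p) a (suc i) (s≤s i≤k) = at-∷ʳʷ p a i i≤k

  takeʷ : (p : Walk H x y k) → ∀ i → i ≤ k → Walk H x (at p i) i
  takeʷ here       zero    _         = here
  takeʷ (step a p) zero    _         = here
  takeʷ (step a p) (suc i) (s≤s i≤k) = step a (takeʷ p i i≤k)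

  dropʷ : (p : Walk H x y k) → ∀ i → i ≤ k → Walk H (at p i) y (k ∸ i)
  dropʷ here       zero    _         = here
  dropʷ (step a p) zero    _         = step a p
  dropʷ (step a p) (suc i) (s≤s i≤k) = dropʷ p i i≤k

module _ {H : Graph} (Adj-sym : Symmetric (Graph.Adj H)) where
  open Graph H

  reverseʷ : ∀ {x y k} → Walk H x y k → Walk H y x k
  reverseʷ here       = here
  reverseʷ (step a p) = reverseʷ p ∷ʳʷ Adj-sym a

  Dist-sym : ∀ {x y k} → Dist H x y k → Dist H y x k
  Dist-sym (p , p-min) = reverseʷ p , λ l q → p-min l (reverseʷ q)

Resolves : (H : Graph) → Subset (Graph.order H) → Fin (Graph.order H) → Fin (Graph.order H) → Set
Resolves H S x y = ∃[ v ] (v ∈ S × ∃[ k ] ∃[ l ] (Dist H x v k × Dist H y v l × k ≢ l))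

module Distance (H : Graph) (Adj? : Decidable (Graph.Adj H)) (Adj-sym : Symmetric (Graph.Adj H))
                (connected : Connected H) where
  open Graph H

  private variable
    x y : Fin order
    k l : ℕ

  walk? : ∀ x y k → Dec (Walk H x y k)
  walk? x y zero with x ≟ᶠ y
  ... | yes refl = yes here
  ... | no x≢y   = no λ p → x≢y (Walk₀⇒≡ p)
  walk? x y (suc k) with any? (λ z → Adj? x z ×-dec walk? z y k)
  ... | yes (z , a , p) = yes (step a p)
  ... | no ∄step        = no λ { (step a p) → ∄step (_ , a , p) }

  -- Opaque, so that dist never unfolds into the well-founded search during unification.
  private opaque
    shortest : ∀ x y → ∃[ j ] (Walk H x y j × (∀ {i} → i < j → ¬ Walk H x y i))
    shortest x y = least-witness (walk? x y) (proj₂ (connected x y))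

  dist : Fin order → Fin order → ℕ
  dist x y = proj₁ (shortest x y)

  geodesic : ∀ x y → Walk H x y (dist x y)
  geodesic x y = proj₁ (proj₂ (shortest x y))

  dist-minimal : Walk H x y l → dist x y ≤ l
  dist-minimal {x} {y} {l} p with dist x y ≤? l
  ... | yes d≤l = d≤l
  ... | no  d≰l = ⊥-elim (proj₂ (proj₂ (shortest x y)) (≰⇒> d≰l) p)

  Dist-dist : ∀ x y → Dist H x y (dist x y)
  Dist-dist x y = geodesic x y , λ _ → dist-minimal

  Dist⇒≡dist : Dist H x y k → k ≡ dist x y
  Dist⇒≡dist d = Dist-unique d (Dist-dist _ _)

  dist-sym : ∀ x y → dist x y ≡ dist y x
  dist-sym x y = Dist⇒≡dist (Dist-sym Adj-sym (Dist-dist x y))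

  dist-refl : ∀ x → dist x x ≡ 0
  dist-refl x = n≤0⇒n≡0 (dist-minimal here)

  dist≡0⇒≡ : dist x y ≡ 0 → x ≡ y
  dist≡0⇒≡ {x} {y} d≡0 = Walk₀⇒≡ (subst (Walk H x y) d≡0 (geodesic x y))

  ≢⇒dist>0 : x ≢ y → 0 < dist x y
  ≢⇒dist>0 x≢y = n≢0⇒n>0 (λ d≡0 → x≢y (dist≡0⇒≡ d≡0))

  dist>0⇒≢ : 0 < dist x y → x ≢ y
  dist>0⇒≢ d>0 refl = <⇒≢ d>0 (sym (dist-refl _))

  dist-triangle : ∀ x y z → dist x z ≤ dist x y + dist y z
  dist-triangle x y z = dist-minimal (geodesic x y ++ʷ geodesic y z)

  dist-stepˡ : Adj x y → ∀ z → dist x z ≤ suc (dist y z)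
  dist-stepˡ a z = dist-minimal (step a (geodesic _ z))

  dist-stepʳ : Adj x y → ∀ z → dist z x ≤ suc (dist z y)
  dist-stepʳ {x} {y} a z = subst₂ (λ u v → u ≤ suc v) (dist-sym x z) (dist-sym y z) (dist-stepˡ a z)

  dist-adjacent : x ≢ y → Adj x y → dist x y ≡ 1
  dist-adjacent x≢y a = ≤-antisym (dist-minimal (step a here)) (≢⇒dist>0 x≢y)

  dist-along-geodesic : (p : Walk H x y k) → dist x y ≡ k → ∀ i → i ≤ k → dist x (at p i) ≡ i
  dist-along-geodesic {x} {y} {k} p d≡k i i≤k =
    ≤-antisym (dist-minimal (takeʷ p i i≤k)) (+-cancelʳ-≤ (k ∸ i) i (dist x (at p i)) (begin
      i + (k ∸ i)                         ≡⟨ m+[n∸m]≡n i≤k ⟩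
      k                                   ≡⟨ d≡k ⟨
      dist x y                            ≤⟨ dist-triangle x (at p i) y ⟩
      dist x (at p i) + dist (at p i) y   ≤⟨ +-monoʳ-≤ (dist x (at p i)) (dist-minimal (dropʷ p i i≤k)) ⟩
      dist x (at p i) + (k ∸ i)           ∎))
    where open ≤-Reasoning

  dist<order : ∀ x y → dist x y < order
  dist<order x y with dist x y <? order
  ... | yes d<n = d<n
  ... | no  d≮n with i , j , i<j , same ← pigeonhole (s≤s (≮⇒≥ d≮n)) (λ i → at (geodesic x y) (toℕ i))
    = ⊥-elim (<-irrefl (trans (sym (position i)) (trans (cong (dist x) same) (position j))) i<j)
    where
      position : ∀ i → dist x (at (geodesic x y) (toℕ i)) ≡ toℕ i
      position i = dist-along-geodesic (geodesic x y) refl (toℕ i) (≤-pred (toℕ<n i))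

  predecessor : ∀ w z d → dist w z ≡ suc d → ∃[ u ] (Adj u z × dist w u ≡ d)
  predecessor w z d d≡ with u , p , a ← unsnocʷ (subst (Walk H w z) d≡ (geodesic w z)) =
    u , a , ≤-antisym (dist-minimal p) (≤-pred (begin
      suc d                     ≡⟨ d≡ ⟨
      dist w z                  ≤⟨ dist-minimal (geodesic w u ∷ʳʷ a) ⟩
      suc (dist w u)            ∎))
    where open ≤-Reasoning

module Simple (G : SimpleGraph) where
  open SimpleGraph G

  private variable
    u x y z : Fin n
    e f : Fin m

  end₁ end₂ : Fin m → Fin n
  end₁ e = proj₁ (ends e)
  end₂ e = proj₂ (ends e)

  Joins : Fin m → Fin n → Fin n → Set
  Joins e x y = ends e ≡ (x , y) ⊎ ends e ≡ (y , x)

  joins-ends : ∀ e → Joins e (end₁ e) (end₂ e)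
  joins-ends e = inj₁ refl

  Joins-sym : Joins e x y → Joins e y x
  Joins-sym = Sum.swap

  Joins⇒Incident : Joins e x y → Incident G x e
  Joins⇒Incident (inj₁ eq) = inj₁ (cong proj₁ eq)
  Joins⇒Incident (inj₂ eq) = inj₂ (cong proj₂ eq)

  Incident⇒Joins : Incident G x e → Incident G y e → x ≢ y → Joins e x y
  Incident⇒Joins (inj₁ refl) (inj₁ refl) x≢y = contradiction refl x≢y
  Incident⇒Joins (inj₁ refl) (inj₂ refl) x≢y = inj₁ refl
  Incident⇒Joins (inj₂ refl) (inj₁ refl) x≢y = inj₂ refl
  Incident⇒Joins (inj₂ refl) (inj₂ refl) x≢y = contradiction refl x≢y

  Incident⇒neighbour : Incident G z e → ∃[ y ] Joins e y z
  Incident⇒neighbour (inj₁ refl) = _ , inj₂ refl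
  Incident⇒neighbour (inj₂ refl) = _ , inj₁ refl

  Joins-same : ∀ {x' y'} → Joins e x y → Joins e x' y' → (x ≡ x' × y ≡ y') ⊎ (x ≡ y' × y ≡ x')
  Joins-same (inj₁ p) (inj₁ q) = inj₁ (,-injective (trans (sym p) q))
  Joins-same (inj₁ p) (inj₂ q) = inj₂ (,-injective (trans (sym p) q))
  Joins-same (inj₂ p) (inj₁ q) = inj₂ (Prod.swap (,-injective (trans (sym p) q)))
  Joins-same (inj₂ p) (inj₂ q) = inj₁ (Prod.swap (,-injective (trans (sym p) q)))

  Joins-unique : Joins e x y → Joins f x y → e ≡ f
  Joins-unique {e} {f = f} (inj₁ p) (inj₁ q) = noMulti e f (inj₁ (trans p (sym q)))
  Joins-unique {e} {f = f} (inj₁ p) (inj₂ q) = noMulti e f (inj₂ (trans p (cong Prod.swap (sym q))))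
  Joins-unique {e} {f = f} (inj₂ p) (inj₁ q) = noMulti e f (inj₂ (trans p (cong Prod.swap (sym q))))
  Joins-unique {e} {f = f} (inj₂ p) (inj₂ q) = noMulti e f (inj₁ (trans p (sym q)))

  SAdj-sym : Symmetric (SAdj G)
  SAdj-sym (e , j) = e , Joins-sym j

  SAdj-irrefl : SAdj G x y → x ≢ y
  SAdj-irrefl (e , inj₁ eq) refl = loopless e (trans (cong proj₁ eq) (sym (cong proj₂ eq)))
  SAdj-irrefl (e , inj₂ eq) refl = loopless e (trans (cong proj₁ eq) (sym (cong proj₂ eq)))

  SAdj? : Decidable (SAdj G)
  SAdj? x y = any? λ e → (ends e ≟ₚ (x , y)) ⊎-dec (ends e ≟ₚ (y , x))
    where _≟ₚ_ = ≡-dec _≟ᶠ_ _≟ᶠ_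

  Incident? : ∀ x e → Dec (Incident G x e)
  Incident? x e = (end₁ e ≟ᶠ x) ⊎-dec (end₂ e ≟ᶠ x)

  other-end : ∀ x e → ∃[ y ] (Incident G y e × y ≢ x)
  other-end x e with end₁ e ≟ᶠ x
  ... | yes refl = end₂ e , inj₂ refl , λ eq → loopless e (sym eq)
  ... | no  ≢x   = end₁ e , inj₁ refl , ≢x

  degree≡1 : SAdj G u z → (∀ {y} → SAdj G y z → y ≡ u) → degree G z ≡ 1
  degree≡1 {u} {z} (e₀ , j₀) only-u = ≤-antisym
      (count-tabulate-≤1 (Incident? z) (λ e → e) λ ie if → Joins-unique (joins-u ie) (joins-u if))
      (filter-some (Incident? z) (Any.tabulate⁺ e₀ (Joins⇒Incident (Joins-sym j₀))))
    where
      joins-u : Incident G z e → Joins e u z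
      joins-u {e} i with y , j ← Incident⇒neighbour i with refl ← only-u (e , j) = j

module Cycles (G : SimpleGraph) where
  open SimpleGraph G
  open Simple G

  -- The cycle runs out along P and back along Q; the ranks ρ keep its vertices apart.
  module _ (ρ : Fin n → ℕ) {a b : ℕ} (P Q : ℕ → Fin n)
           (1≤a : 1 ≤ a) (a≤b : a ≤ b) (b≤1+a : b ≤ suc a)
           (ρ-P : ∀ {i} → i ≤ a → ρ (P i) ≡ i) (ρ-Q : ∀ {i} → i ≤ b → ρ (Q i) ≡ i)
           (P₀≡Q₀ : P 0 ≡ Q 0) (P≢Q : ∀ {i} → 1 ≤ i → i ≤ a → P i ≢ Q i)
           (P-path : ∀ {i} → suc i ≤ a → SAdj G (P i) (P (suc i)))
           (Q-path : ∀ {i} → suc i ≤ b → SAdj G (Q i) (Q (suc i)))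
           (P-Q : SAdj G (P a) (Q b)) where
    private
      L : ℕ
      L = suc (a + b)

      C : ℕ → Fin n
      C i with i ≤? a
      ... | yes _ = P i
      ... | no  _ = Q (L ∸ i)

      C-P : ∀ {i} → i ≤ a → C i ≡ P i
      C-P {i} i≤a with i ≤? a
      ... | yes _   = refl
      ... | no  i≰a = contradiction i≤a i≰a

      C-Q : ∀ {i} → ¬ i ≤ a → C i ≡ Q (L ∸ i)
      C-Q {i} i≰a with i ≤? a
      ... | yes i≤a = contradiction i≤a i≰a
      ... | no  _   = refl

      L∸i≤b : ∀ {i} → ¬ i ≤ a → L ∸ i ≤ b
      L∸i≤b i≰a = m≤n+o⇒m∸n≤o L _ (+-monoˡ-≤ b (≰⇒> i≰a))

      ρ-C-P : ∀ {i} → i ≤ a → ρ (C i) ≡ i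
      ρ-C-P i≤a = trans (cong ρ (C-P i≤a)) (ρ-P i≤a)

      ρ-C-Q : ∀ {i} → ¬ i ≤ a → ρ (C i) ≡ L ∸ i
      ρ-C-Q i≰a = trans (cong ρ (C-Q i≰a)) (ρ-Q (L∸i≤b i≰a))

      C-apart : ∀ {i i'} → i ≤ a → ¬ i' ≤ a → i' < L → C i ≢ C i'
      C-apart {i} {i'} i≤a i'≰a i'<L Ci≡Ci' = P≢Q 1≤i i≤a (begin
          P i          ≡⟨ C-P i≤a ⟨
          C i          ≡⟨ Ci≡Ci' ⟩
          C i'         ≡⟨ C-Q i'≰a ⟩
          Q (L ∸ i')   ≡⟨ cong Q i≡L∸i' ⟨
          Q i          ∎)
        where
          open ≡-Reasoning
          i≡L∸i' : i ≡ L ∸ i'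
          i≡L∸i' = trans (sym (ρ-C-P i≤a)) (trans (cong ρ Ci≡Ci') (ρ-C-Q i'≰a))
          1≤i : 1 ≤ i
          1≤i = subst (1 ≤_) (sym i≡L∸i') (m<n⇒0<n∸m i'<L)

      C-injective : ∀ i i' → i < L → i' < L → C i ≡ C i' → i ≡ i'
      C-injective i i' i<L i'<L eq with toSum (i ≤? a) | toSum (i' ≤? a)
      ... | inj₁ i≤a | inj₁ i'≤a = trans (sym (ρ-C-P i≤a)) (trans (cong ρ eq) (ρ-C-P i'≤a))
      ... | inj₁ i≤a | inj₂ i'≰a = contradiction eq (C-apart i≤a i'≰a i'<L)
      ... | inj₂ i≰a | inj₁ i'≤a = contradiction (sym eq) (C-apart i'≤a i≰a i<L)
      ... | inj₂ i≰a | inj₂ i'≰a = ∸-cancelˡ-≡ (<⇒≤ i<L) (<⇒≤ i'<L)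
                                   (trans (sym (ρ-C-Q i≰a)) (trans (cong ρ eq) (ρ-C-Q i'≰a)))

      C-adjacent : ∀ i → suc i < L → SAdj G (C i) (C (suc i))
      C-adjacent i 1+i<L with toSum (suc i ≤? a) | toSum (i ≤? a)
      ... | inj₁ 1+i≤a | _ = subst₂ (SAdj G) (sym (C-P (<⇒≤ 1+i≤a))) (sym (C-P 1+i≤a)) (P-path 1+i≤a)
      ... | inj₂ 1+i≰a | inj₁ i≤a = subst₂ (SAdj G) (sym (trans (C-P i≤a) (cong P i≡a)))
                                   (sym (trans (C-Q 1+i≰a) (cong Q L∸[1+i]≡b))) P-Q
        where
          i≡a : i ≡ a
          i≡a = ≤-antisym i≤a (≤-pred (≰⇒> 1+i≰a))
          L∸[1+i]≡b : L ∸ suc i ≡ b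
          L∸[1+i]≡b = trans (cong (λ t → L ∸ suc t) i≡a) (m+n∸m≡n a b)
      ... | inj₂ 1+i≰a | inj₂ i≰a = subst₂ (SAdj G) (sym (trans (C-Q i≰a) (cong Q L∸i≡1+L∸[1+i])))
                                  (sym (C-Q 1+i≰a))
                                  (SAdj-sym (Q-path (subst (_≤ b) L∸i≡1+L∸[1+i] (L∸i≤b i≰a))))
        where
          L∸i≡1+L∸[1+i] : L ∸ i ≡ suc (L ∸ suc i)
          L∸i≡1+L∸[1+i] = +-∸-assoc 1 (<⇒≤ (≤-pred 1+i<L))

      1≤b : 1 ≤ b
      1≤b = ≤-trans 1≤a a≤b

      C-closing : SAdj G (C (L ∸ 1)) (C 0)
      C-closing = subst₂ (SAdj G) (sym (trans (C-Q a+b≰a) (cong Q (m+n∸n≡m 1 (a + b)))))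
                    (sym (trans (C-P z≤n) P₀≡Q₀)) (SAdj-sym (Q-path 1≤b))
        where
          a+b≰a : ¬ (a + b ≤ a)
          a+b≰a a+b≤a = <⇒≱ (m<m+n a 1≤b) a+b≤a

    ranked-fork⇒cycle : HasCycle G
    ranked-fork⇒cycle = L , s≤s (+-mono-≤ 1≤a 1≤b) , C , C-injective , C-adjacent , C-closing

module Connected (G : SimpleGraph) (connected : Connected (toGraph G)) where
  open SimpleGraph G
  open Simple G public
  open Distance (toGraph G) SAdj? SAdj-sym connected public
  open Cycles G

  -- Cut both geodesics at their last common vertex: ranked by the distance from w,
  -- what remains is a fork as in ranked-fork⇒cycle.
  geodesics⇒cycle : ∀ {w x y k k'} (p : Walk (toGraph G) w x k) (q : Walk (toGraph G) w y k') →
                    dist w x ≡ k → dist w y ≡ k' → k ≤ k' → k' ≤ suc k →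
                    x ≢ at q k → SAdj G x y → HasCycle G
  geodesics⇒cycle {w} {x} {y} {k} {k'} p q dx dy k≤k' k'≤1+k x≢ xy
    with j , j≤k , agree , apart ← last-agreement _≟ᶠ_ (at p) (at q) (trans (at-start p) (sym (at-start q))) k
    = ranked-fork⇒cycle (λ v → dist w v ∸ j) (λ i → at p (i + j)) (λ i → at q (i + j))
        (m<n⇒0<n∸m j<k) (∸-monoˡ-≤ j k≤k')
        (≤-trans (∸-monoˡ-≤ j k'≤1+k) (≤-reflexive (+-∸-assoc 1 j≤k)))
        (λ {i} i≤a → rank p dx j≤k i≤a) (λ {i} i≤b → rank q dy j≤k' i≤b)
        agree
        (λ {i} 1≤i i≤a → apart (m<n+m j 1≤i) (m≤o∸n⇒m+n≤o i j≤k i≤a))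
        (λ {i} i<a → at-adjacent p (i + j) (m≤o∸n⇒m+n≤o (suc i) j≤k i<a))
        (λ {i} i<b → at-adjacent q (i + j) (m≤o∸n⇒m+n≤o (suc i) j≤k' i<b))
        (subst₂ (λ s t → SAdj G (at p s) (at q t)) (sym (m∸n+n≡m j≤k)) (sym (m∸n+n≡m j≤k'))
          (subst₂ (SAdj G) (sym (at-end p)) (sym (at-end q)) xy))
    where
      j≤k' : j ≤ k'
      j≤k' = ≤-trans j≤k k≤k'
      j<k : j < k
      j<k = ≤∧≢⇒< j≤k λ { refl → x≢ (trans (sym (at-end p)) agree) }
      rank : ∀ {z K} (r : Walk (toGraph G) w z K) → dist w z ≡ K → ∀ {i} → j ≤ K → i ≤ K ∸ j →
             dist w (at r (i + j)) ∸ j ≡ i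
      rank r dz {i} j≤K i≤ = trans (cong (_∸ j) (dist-along-geodesic r dz (i + j) (m≤o∸n⇒m+n≤o i j≤K i≤)))
                                   (m+n∸n≡m i j)

  dist-edge : Fin m → Fin n → ℕ
  dist-edge e z = dist (end₁ e) z ⊓ dist (end₂ e) z

  incident-close : ∀ {x y e} → Incident G x e → Incident G y e → ∀ z → dist x z ≤ suc (dist y z)
  incident-close (inj₁ refl) (inj₁ refl) z = n≤1+n _
  incident-close (inj₁ refl) (inj₂ refl) z = dist-stepˡ (_ , joins-ends _) z
  incident-close (inj₂ refl) (inj₁ refl) z = dist-stepˡ (_ , Joins-sym (joins-ends _)) z
  incident-close (inj₂ refl) (inj₂ refl) z = n≤1+n _

  dist-edge≤dist : ∀ {x e} → Incident G x e → ∀ z → dist-edge e z ≤ dist x z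
  dist-edge≤dist (inj₁ refl) z = m⊓n≤m _ _
  dist-edge≤dist (inj₂ refl) z = m⊓n≤n _ _

  dist≤1+dist-edge : ∀ {x e} → Incident G x e → ∀ z → dist x z ≤ suc (dist-edge e z)
  dist≤1+dist-edge i z = ⊓-glb (incident-close i (inj₁ refl) z) (incident-close i (inj₂ refl) z)

  dist-edge-Joins : ∀ {e x y} → Joins e x y → ∀ z → dist-edge e z ≡ dist x z ⊓ dist y z
  dist-edge-Joins (inj₁ refl) z = refl
  dist-edge-Joins (inj₂ refl) z = ⊓-comm _ _

  dist-edge-incident : ∀ {x e} → Incident G x e → dist-edge e x ≡ 0
  dist-edge-incident {x} i = n≤0⇒n≡0 (≤-trans (dist-edge≤dist i x) (≤-reflexive (dist-refl x)))

  resolves-by : ∀ {S x y} α → α ∈ S → dist x α ≢ dist y α → Resolves (toGraph G) S x y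
  resolves-by α α∈S ≢ = α , α∈S , _ , _ , Dist-dist _ α , Dist-dist _ α , ≢

  T : Graph
  T = totalGraph G

  TAdj-sym : Symmetric (TAdj G)
  TAdj-sym (vv a)       = vv (SAdj-sym a)
  TAdj-sym (ve i)       = ev i
  TAdj-sym (ev i)       = ve i
  TAdj-sym (ee e≢f i j) = ee (λ eq → e≢f (sym eq)) j i

  liftʷ : ∀ {x y k} → Walk (toGraph G) x y k → Walk T (x ↑ˡ m) (y ↑ˡ m) k
  liftʷ here       = here
  liftʷ (step a p) = step (vv a) (liftʷ p)

  -- A 1-Lipschitz potential on T(G) vanishing at ℓ, hence a lower bound for the distance to ℓ.
  dist-T : Fin n → Fin (n + m) → ℕ
  dist-T ℓ t = [ (λ x → dist x ℓ) , (λ e → suc (dist-edge e ℓ)) ]′ (splitAt n t)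

  dist-T-lipschitz : ∀ ℓ {s t} → TAdj G s t → dist-T ℓ s ≤ suc (dist-T ℓ t)
  dist-T-lipschitz ℓ (vv {x} {y} a) rewrite splitAt-↑ˡ n x m | splitAt-↑ˡ n y m = dist-stepˡ a ℓ
  dist-T-lipschitz ℓ (ve {x} {e} i) rewrite splitAt-↑ˡ n x m | splitAt-↑ʳ n m e =
    m≤n⇒m≤1+n (dist≤1+dist-edge i ℓ)
  dist-T-lipschitz ℓ (ev {x} {e} i) rewrite splitAt-↑ˡ n x m | splitAt-↑ʳ n m e = s≤s (dist-edge≤dist i ℓ)
  dist-T-lipschitz ℓ (ee {x} {e} {f} _ i j) rewrite splitAt-↑ʳ n m e | splitAt-↑ʳ n m f =
    s≤s (≤-trans (dist-edge≤dist i ℓ) (dist≤1+dist-edge j ℓ))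

  dist-T-minimal : ∀ ℓ {t k} → Walk T t (ℓ ↑ˡ m) k → dist-T ℓ t ≤ k
  dist-T-minimal ℓ {t} {k} r = subst (dist-T ℓ t ≤_) k+0≡k (walk-lipschitz (dist-T ℓ) (dist-T-lipschitz ℓ) r)
    where
      k+0≡k : k + dist-T ℓ (ℓ ↑ˡ m) ≡ k
      k+0≡k rewrite splitAt-↑ˡ n ℓ m | dist-refl ℓ = +-identityʳ k

  Dist-T-vertex : ∀ x ℓ → Dist T (x ↑ˡ m) (ℓ ↑ˡ m) (dist x ℓ)
  Dist-T-vertex x ℓ = liftʷ (geodesic x ℓ) ,
                      λ _ r → subst (_≤ _) (cong [ _ , _ ]′ (splitAt-↑ˡ n x m)) (dist-T-minimal ℓ r)

  Dist-T-edge : ∀ e ℓ → Dist T (n ↑ʳ e) (ℓ ↑ˡ m) (suc (dist-edge e ℓ))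
  Dist-T-edge e ℓ = walk (⊓-sel (dist (end₁ e) ℓ) (dist (end₂ e) ℓ)) ,
                    λ _ r → subst (_≤ _) (cong [ _ , _ ]′ (splitAt-↑ʳ n m e)) (dist-T-minimal ℓ r)
    where
      walk : dist-edge e ℓ ≡ dist (end₁ e) ℓ ⊎ dist-edge e ℓ ≡ dist (end₂ e) ℓ →
             Walk T (n ↑ʳ e) (ℓ ↑ˡ m) (suc (dist-edge e ℓ))
      walk (inj₁ eq) rewrite eq = step (ev (inj₁ refl)) (liftʷ (geodesic _ ℓ))
      walk (inj₂ eq) rewrite eq = step (ev (inj₂ refl)) (liftʷ (geodesic _ ℓ))

module Tree (G : SimpleGraph) (connected : Connected (toGraph G)) (acyclic : ¬ HasCycle G) where
  open SimpleGraph G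
  open Connected G connected public

  private variable
    a b c p u w x y z z' α : Fin n
    e f g h : Fin m

  adjacent⇒dist≢ : ∀ w → SAdj G x y → dist w x ≢ dist w y
  adjacent⇒dist≢ {x} {y} w xy eq = acyclic (geodesics⇒cycle (geodesic w x) (geodesic w y) refl refl
    (≤-reflexive eq) (subst (_≤ suc (dist w x)) eq (n≤1+n _))
    (λ x≡ → SAdj-irrefl xy (trans x≡ (trans (cong (at (geodesic w y)) eq) (at-end (geodesic w y)))))
    xy)

  parent-unique : ∀ w → SAdj G x z → SAdj G y z → dist w x ≡ dist w y → dist w z ≡ suc (dist w x) → x ≡ y
  parent-unique {x} {z} {y} w xz yz eq dz with x ≟ᶠ y
  ... | yes x≡y = x≡y
  ... | no  x≢y = ⊥-elim (acyclic (geodesics⇒cycle (geodesic w x) (geodesic w y ∷ʳʷ yz) refl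
    (trans dz (cong suc eq)) (≤-trans (≤-reflexive eq) (n≤1+n _)) (s≤s (≤-reflexive (sym eq)))
    (λ x≡ → x≢y (trans x≡ (begin
      at (geodesic w y ∷ʳʷ yz) (dist w x)   ≡⟨ cong (at (geodesic w y ∷ʳʷ yz)) eq ⟩
      at (geodesic w y ∷ʳʷ yz) (dist w y)   ≡⟨ at-∷ʳʷ (geodesic w y) yz _ ≤-refl ⟩
      at (geodesic w y) (dist w y)          ≡⟨ at-end (geodesic w y) ⟩
      y                                     ∎)))
    xz))
    where open ≡-Reasoning

  Closer : Fin n → Fin n → Fin n → Set
  Closer a b z = dist a z < dist b z

  side : SAdj G a b → ∀ z → Closer a b z ⊎ Closer b a z
  side {a} {b} ab z with <-cmp (dist a z) (dist b z)
  ... | tri< lt _ _ = inj₁ lt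
  ... | tri≈ _ eq _ = ⊥-elim (adjacent⇒dist≢ z ab (trans (dist-sym z a) (trans eq (dist-sym b z))))
  ... | tri> _ _ gt = inj₂ gt

  Closer-self : SAdj G b a → Closer a b a
  Closer-self {b} {a} ba = subst (_< dist b a) (sym (dist-refl a)) (≢⇒dist>0 (SAdj-irrefl ba))

  Closer⇒dist≡suc : SAdj G a b → Closer a b z → dist b z ≡ suc (dist a z)
  Closer⇒dist≡suc ab closer = ≤-antisym (dist-stepˡ (SAdj-sym ab) _) closer

  crossing-edge : SAdj G a b → SAdj G z z' → Closer a b z → Closer b a z' → z ≡ a × z' ≡ b
  crossing-edge {a} {b} {z} {z'} ab zz' cz cz' = descend (dist a z) refl
    where
      dbz≡ : dist b z ≡ suc (dist a z)
      dbz≡ = Closer⇒dist≡suc ab cz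
      daz'≡ : dist a z' ≡ suc (dist b z')
      daz'≡ = Closer⇒dist≡suc (SAdj-sym ab) cz'
      dbz'≡ : dist b z' ≡ dist a z
      dbz'≡ = ≤-antisym (≤-pred (subst (_≤ suc (dist a z)) daz'≡ (dist-stepʳ (SAdj-sym zz') a)))
                        (≤-pred (subst (_≤ suc (dist b z')) dbz≡ (dist-stepʳ zz' b)))
      -- For z ≢ a, the neighbour of z' towards b would be a second parent of z' seen from a.
      descend : ∀ k → dist a z ≡ k → z ≡ a × z' ≡ b
      descend zero    d≡0 = sym (dist≡0⇒≡ d≡0) , sym (dist≡0⇒≡ (trans dbz'≡ d≡0))
      descend (suc k) d≡ with u , uz' , dbu ← predecessor b z' k (trans dbz'≡ d≡) =
        contradiction k≡2+k (<⇒≢ (m<n⇒m<1+n (n<1+n k)))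
        where
          dau≡ : dist a u ≡ dist a z
          dau≡ = ≤-antisym
            (≤-trans (dist-triangle a b u)
              (≤-reflexive (trans (cong₂ _+_ (dist-adjacent (SAdj-irrefl ab) ab) dbu) (sym d≡))))
            (≤-pred (subst (_≤ suc (dist a u)) (trans daz'≡ (cong suc dbz'≡)) (dist-stepʳ (SAdj-sym uz') a)))
          z≡u : z ≡ u
          z≡u = parent-unique a zz' uz' (sym dau≡) (trans daz'≡ (cong suc dbz'≡))
          k≡2+k : k ≡ suc (suc k)
          k≡2+k = begin
            k             ≡⟨ dbu ⟨
            dist b u      ≡⟨ cong (dist b) z≡u ⟨
            dist b z      ≡⟨ dbz≡ ⟩
            suc (dist a z) ≡⟨ cong suc d≡ ⟩
            suc (suc k)   ∎
            where open ≡-Reasoning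

  walk-across : SAdj G a b → Closer b a α → Closer a b z → ∀ {k} → Walk (toGraph G) z α k →
                dist a z + suc (dist b α) ≤ k
  walk-across ab cα cz here = ⊥-elim (<-asym cz cα)
  walk-across {a} {b} {α} ab cα cz (step {y = z₁} zz₁ r) with side ab z₁
  ... | inj₁ cz₁ = ≤-trans (+-monoˡ-≤ _ (dist-stepʳ zz₁ a)) (s≤s (walk-across ab cα cz₁ r))
  ... | inj₂ cz₁ with refl , refl ← crossing-edge ab zz₁ cz cz₁ =
    subst (λ d → d + suc (dist b α) ≤ _) (sym (dist-refl a)) (s≤s (dist-minimal r))

  equidistant-across : SAdj G c p → Closer c p x → Closer p c y → dist c x ≡ dist c y →
                       Closer p c α → dist y α < dist x α
  equidistant-across {c} {p} {x} {y} {α} cp cx cy eq cα = begin-strict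
    dist y α                            ≤⟨ dist-triangle y p α ⟩
    dist y p + dist p α                 ≡⟨ cong (_+ dist p α) (dist-sym y p) ⟩
    dist p y + dist p α                 <⟨ s≤s (+-monoʳ-≤ (dist p y) (n≤1+n _)) ⟩
    suc (dist p y) + suc (dist p α)     ≡⟨ cong (_+ suc (dist p α)) dcx ⟨
    dist c x + suc (dist p α)           ≤⟨ walk-across cp cα cx (geodesic x α) ⟩
    dist x α                            ∎
    where
      open ≤-Reasoning
      dcx : dist c x ≡ suc (dist p y)
      dcx = trans eq (Closer⇒dist≡suc {z = y} (SAdj-sym cp) cy)

  split-by-edge : SAdj G c p → dist c x ≡ dist c y → dist c x ⊓ dist p x ≢ dist c y ⊓ dist p y →
                  Closer p c α → dist x α ≢ dist y α
  split-by-edge {c} {p} {x} {y} cp eq ≢ cα with side cp x | side cp y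
  ... | inj₁ cx | inj₁ cy = contradiction (begin
          dist c x ⊓ dist p x   ≡⟨ m≤n⇒m⊓n≡m (<⇒≤ cx) ⟩
          dist c x              ≡⟨ eq ⟩
          dist c y              ≡⟨ m≤n⇒m⊓n≡m (<⇒≤ cy) ⟨
          dist c y ⊓ dist p y   ∎) ≢
    where open ≡-Reasoning
  ... | inj₁ cx | inj₂ cy = ≢-sym (<⇒≢ (equidistant-across cp cx cy eq cα))
  ... | inj₂ cx | inj₁ cy = <⇒≢ (equidistant-across cp cy cx (sym eq) cα)
  ... | inj₂ cx | inj₂ cy = contradiction (begin
          dist c x ⊓ dist p x   ≡⟨ m≥n⇒m⊓n≡n (<⇒≤ cx) ⟩
          dist p x              ≡⟨ suc-injective (begin
            suc (dist p x)        ≡⟨ Closer⇒dist≡suc (SAdj-sym cp) cx ⟨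
            dist c x              ≡⟨ eq ⟩
            dist c y              ≡⟨ Closer⇒dist≡suc (SAdj-sym cp) cy ⟩
            suc (dist p y)        ∎) ⟩
          dist p y              ≡⟨ m≥n⇒m⊓n≡n (<⇒≤ cy) ⟨
          dist c y ⊓ dist p y   ∎) ≢
    where open ≡-Reasoning

  edge-on-one-side : Joins h a b → g ≢ h → Incident G x g → Incident G y g → Closer a b x → Closer a b y
  edge-on-one-side {h} {g = g} {x} {y} jh g≢h ix iy cx with x ≟ᶠ y
  ... | yes refl = cx
  ... | no  x≢y with side (h , jh) y
  ...   | inj₁ cy = cy
  ...   | inj₂ cy with refl , refl ← crossing-edge (h , jh) (g , Incident⇒Joins ix iy x≢y) cx cy =
    contradiction (Joins-unique (Incident⇒Joins ix iy x≢y) jh) g≢h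

  leaf-at-end : 0 < dist w z → ¬ (∃[ z' ] (SAdj G z z' × dist w z' ≡ suc (dist w z))) → degree G z ≡ 1
  leaf-at-end {w} {z} 0<d ∄farther with dist w z in dz
  ... | suc d with u , uz , du ← predecessor w z d dz = degree≡1 uz only-u
    where
      only-u : ∀ {y} → SAdj G y z → y ≡ u
      only-u {y} yz = parent-unique w yz uz (trans dy (sym du)) (trans dz (cong suc (sym dy)))
        where
          d≤dy : d ≤ dist w y
          d≤dy = ≤-pred (subst (_≤ suc (dist w y)) dz (dist-stepʳ (SAdj-sym yz) w))
          dy≤2+d : dist w y ≤ suc (suc d)
          dy≤2+d = subst (λ t → dist w y ≤ suc t) dz (dist-stepʳ yz w)
          dy : dist w y ≡ d
          dy with m≤n⇒m<n∨m≡n dy≤2+d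
          ... | inj₂ dy≡2+d = contradiction (y , SAdj-sym yz , dy≡2+d) ∄farther
          ... | inj₁ dy<2+d with m≤n⇒m<n∨m≡n (≤-pred dy<2+d)
          ...   | inj₂ dy≡1+d = contradiction (trans dy≡1+d (sym dz)) (adjacent⇒dist≢ w yz)
          ...   | inj₁ dy<1+d = ≤-antisym (≤-pred dy<1+d) d≤dy

  -- Walk from u away from w until no neighbour is farther from w; there the walk ends in a leaf.
  leaf-beyond : u ≢ w → ∃[ ℓ ] (degree G ℓ ≡ 1 × dist u ℓ + dist u w ≤ dist w ℓ)
  leaf-beyond {u} {w} u≢w =
    climb n u (m≤n+m n _) (≤-reflexive (trans (cong (_+ dist u w) (dist-refl u)) (dist-sym u w)))
    where
      climb : ∀ fuel z → n ≤ dist w z + fuel → dist u z + dist u w ≤ dist w z →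
              ∃[ ℓ ] (degree G ℓ ≡ 1 × dist u ℓ + dist u w ≤ dist w ℓ)
      climb fuel z bound inv with any? (λ z' → SAdj? z z' ×-dec (dist w z' ≟ suc (dist w z)))
      ... | no ∄farther =
        z , leaf-at-end (<-≤-trans (<-≤-trans (≢⇒dist>0 u≢w) (m≤n+m _ _)) inv) ∄farther , inv
      climb zero z bound inv | yes _ =
        ⊥-elim (<⇒≱ (dist<order w z) (subst (n ≤_) (+-identityʳ _) bound))
      climb (suc fuel) z bound inv | yes (z' , zz' , dz') = climb fuel z'
        (subst (n ≤_) (trans (+-suc _ fuel) (cong (_+ fuel) (sym dz'))) bound)
        (≤-trans (+-monoˡ-≤ (dist u w) (dist-stepʳ (SAdj-sym zz') u)) (subst (_ ≤_) (sym dz') (s≤s inv)))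

  -- The leaves resolve T(G)
  vertex-vertex-leaf : x ≢ y → ∃[ ℓ ] (degree G ℓ ≡ 1 × dist x ℓ < dist y ℓ)
  vertex-vertex-leaf {x} {y} x≢y with ℓ , leaf , beyond ← leaf-beyond x≢y =
    ℓ , leaf , ≤-trans (≤-reflexive (+-comm 1 (dist x ℓ)))
                 (≤-trans (+-monoʳ-≤ (dist x ℓ) (≢⇒dist>0 x≢y)) beyond)

  vertex-edge-leaf : ∀ x e → ∃[ ℓ ] (degree G ℓ ≡ 1 × dist x ℓ < suc (dist-edge e ℓ))
  vertex-edge-leaf x e with b , ib , b≢x ← other-end x e
    with ℓ , leaf , x<b ← vertex-vertex-leaf (≢-sym b≢x) =
    ℓ , leaf , <-≤-trans x<b (dist≤1+dist-edge ib ℓ)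

  far-endpoint : Joins e a b → e ≢ f → Closer a b (end₁ f) → ∃[ w ] (Incident G w f × 2 ≤ dist b w)
  far-endpoint {e} {a} {b} {f} j e≢f c₁ with w , iw , w≢a ← other-end a f =
    w , iw , subst (2 ≤_) (sym (Closer⇒dist≡suc (e , j) (edge-on-one-side j (≢-sym e≢f) (inj₁ refl) iw c₁)))
                   (s≤s (≢⇒dist>0 (≢-sym w≢a)))

  edge-edge-leaf′ : Joins e a b → e ≢ f → Closer a b (end₁ f) →
                    ∃[ ℓ ] (degree G ℓ ≡ 1 × dist-edge e ℓ < dist-edge f ℓ)
  edge-edge-leaf′ {e} {a} {b} {f} j e≢f c₁ with w , iw , 2≤dbw ← far-endpoint j e≢f c₁
    with ℓ , leaf , beyond ← leaf-beyond (dist>0⇒≢ (<-≤-trans z<s 2≤dbw)) =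
    ℓ , leaf , ≤-pred (begin
      suc (suc (dist-edge e ℓ))    ≤⟨ s≤s (s≤s (dist-edge≤dist (Joins⇒Incident (Joins-sym j)) ℓ)) ⟩
      suc (suc (dist b ℓ))         ≡⟨ +-comm 2 (dist b ℓ) ⟩
      dist b ℓ + 2                 ≤⟨ +-monoʳ-≤ (dist b ℓ) 2≤dbw ⟩
      dist b ℓ + dist b w          ≤⟨ beyond ⟩
      dist w ℓ                     ≤⟨ dist≤1+dist-edge iw ℓ ⟩
      suc (dist-edge f ℓ)          ∎)
    where open ≤-Reasoning

  edge-edge-leaf : e ≢ f → ∃[ ℓ ] (degree G ℓ ≡ 1 × dist-edge e ℓ < dist-edge f ℓ)
  edge-edge-leaf {e} {f} e≢f with side (e , joins-ends e) (end₁ f)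
  ... | inj₁ c₁ = edge-edge-leaf′ (joins-ends e) e≢f c₁
  ... | inj₂ c₁ = edge-edge-leaf′ (Joins-sym (joins-ends e)) e≢f c₁

  leaf-indicator : Subset n
  leaf-indicator = Vec.tabulate (λ x → does (degree G x ≟ 1))

  leaf-set : Subset (n + m)
  leaf-set = image leaf-indicator (_↑ˡ m)

  ∣leaf-set∣≤leaves : ∣ leaf-set ∣ ≤ leaves G
  ∣leaf-set∣≤leaves = ≤-trans (∣image∣≤ leaf-indicator (_↑ˡ m))
                              (≤-reflexive (count-tabulate (λ x → degree G x ≟ 1) (λ x → x)))

  leaf∈leaf-set : ∀ {ℓ} → degree G ℓ ≡ 1 → ℓ ↑ˡ m ∈ leaf-set
  leaf∈leaf-set {ℓ} leaf = ∈image leaf-indicator (_↑ˡ m)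
    (lookup⇒[]= ℓ leaf-indicator
      (trans (lookup∘tabulate (λ x → does (degree G x ≟ 1)) ℓ) (dec-true (degree G ℓ ≟ 1) leaf)))

  leaf-set-resolves : Resolving T leaf-set
  leaf-set-resolves t t' t≢t' = resolve (sumView n m t) (sumView n m t') t≢t'
    where
      by-leaf : ∀ {t t' k l} ℓ → degree G ℓ ≡ 1 → Dist T t (ℓ ↑ˡ m) k → Dist T t' (ℓ ↑ˡ m) l → k ≢ l →
                Resolves T leaf-set t t'
      by-leaf ℓ leaf dk dl k≢l = ℓ ↑ˡ m , leaf∈leaf-set leaf , _ , _ , dk , dl , k≢l

      resolve : ∀ {t t'} → SumView n m t → SumView n m t' → t ≢ t' → Resolves T leaf-set t t'
      resolve (inˡ x) (inˡ y) x≢y with ℓ , leaf , lt ← vertex-vertex-leaf (λ { refl → x≢y refl }) =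
        by-leaf ℓ leaf (Dist-T-vertex x ℓ) (Dist-T-vertex y ℓ) (<⇒≢ lt)
      resolve (inˡ x) (inʳ e) _ with ℓ , leaf , lt ← vertex-edge-leaf x e =
        by-leaf ℓ leaf (Dist-T-vertex x ℓ) (Dist-T-edge e ℓ) (<⇒≢ lt)
      resolve (inʳ e) (inˡ x) _ with ℓ , leaf , lt ← vertex-edge-leaf x e =
        by-leaf ℓ leaf (Dist-T-edge e ℓ) (Dist-T-vertex x ℓ) (≢-sym (<⇒≢ lt))
      resolve (inʳ e) (inʳ f) e≢f with ℓ , leaf , lt ← edge-edge-leaf (λ { refl → e≢f refl }) =
        by-leaf ℓ leaf (Dist-T-edge e ℓ) (Dist-T-edge f ℓ) (<⇒≢ (s≤s lt))

  -- Projecting a resolving set of T(G) onto G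
  module Rooted (ρ : Fin n) where

    orientation : ∀ e → ∃[ c ] ∃[ p ] (Joins e c p × Closer p c ρ)
    orientation e with side (e , joins-ends e) ρ
    ... | inj₁ c₁ = end₂ e , end₁ e , Joins-sym (joins-ends e) , c₁
    ... | inj₂ c₂ = end₁ e , end₂ e , joins-ends e , c₂

    child parent : Fin m → Fin n
    child  e = proj₁ (orientation e)
    parent e = proj₁ (proj₂ (orientation e))

    Joins-child-parent : ∀ e → Joins e (child e) (parent e)
    Joins-child-parent e = proj₁ (proj₂ (proj₂ (orientation e)))

    parent-closer : ∀ e → Closer (parent e) (child e) ρ
    parent-closer e = proj₂ (proj₂ (proj₂ (orientation e)))

    orientation-unique : Joins e c p → Closer p c ρ → child e ≡ c × parent e ≡ p
    orientation-unique {e} j cρ with Joins-same (Joins-child-parent e) j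
    ... | inj₁ same          = same
    ... | inj₂ (refl , refl) = contradiction (parent-closer e) (<-asym cρ)

    project : Fin (n + m) → Fin n
    project t = [ (λ x → x) , child ]′ (splitAt n t)

    vertex∈image : ∀ {S} → x ↑ˡ m ∈ S → x ∈ image S project
    vertex∈image {x} {S} x∈S =
      subst (_∈ image S project) (cong [ _ , _ ]′ (splitAt-↑ˡ n x m)) (∈image S project x∈S)

    child∈image : ∀ {S} → n ↑ʳ e ∈ S → child e ∈ image S project
    child∈image {e} {S} e∈S =
      subst (_∈ image S project) (cong [ _ , _ ]′ (splitAt-↑ʳ n m e)) (∈image S project e∈S)

    Anchored : Subset (n + m) → Set
    Anchored S = ∀ {e} → n ↑ʳ e ∈ S → ∃[ α ] (α ∈ image S project × Closer (parent e) (child e) α)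

    projection-resolves : ∀ S → Resolving T S → Anchored S → Resolving (toGraph G) (image S project)
    projection-resolves S S-res anchored x y x≢y
      with t , t∈S , _ , _ , dx , dy , dx≢dy ← S-res (x ↑ˡ m) (y ↑ˡ m) (λ eq → x≢y (↑ˡ-injective m x y eq)) =
      via (sumView n m t) t∈S dx dy dx≢dy
      where
        via : ∀ {t k l} → SumView n m t → t ∈ S → Dist T (x ↑ˡ m) t k → Dist T (y ↑ˡ m) t l → k ≢ l →
              Resolves (toGraph G) (image S project) x y
        via (inˡ z) z∈S dx dy dx≢dy = resolves-by z (vertex∈image z∈S) λ eq → dx≢dy (begin
          _          ≡⟨ Dist-unique dx (Dist-T-vertex x z) ⟩
          dist x z   ≡⟨ eq ⟩
          dist y z   ≡⟨ Dist-unique (Dist-T-vertex y z) dy ⟩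
          _          ∎)
          where open ≡-Reasoning
        via (inʳ e) e∈S dx dy dx≢dy with dist x (child e) ≟ dist y (child e)
        ... | no  ≢ = resolves-by (child e) (child∈image e∈S) ≢
        ... | yes eq with α , α∈S' , cα ← anchored e∈S =
          resolves-by α α∈S' (split-by-edge (e , Joins-child-parent e)
            (trans (dist-sym (child e) x) (trans eq (dist-sym y (child e)))) min≢ cα)
          where
            min≢ : dist (child e) x ⊓ dist (parent e) x ≢ dist (child e) y ⊓ dist (parent e) y
            min≢ eq = dx≢dy (begin
              _                                          ≡⟨ Dist-unique dx (Dist-sym TAdj-sym (Dist-T-edge e x)) ⟩
              suc (dist-edge e x)                        ≡⟨ cong suc (dist-edge-Joins (Joins-child-parent e) x) ⟩
              suc (dist (child e) x ⊓ dist (parent e) x) ≡⟨ cong suc eq ⟩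
              suc (dist (child e) y ⊓ dist (parent e) y) ≡⟨ cong suc (dist-edge-Joins (Joins-child-parent e) y) ⟨
              suc (dist-edge e y)                        ≡⟨ Dist-unique (Dist-sym TAdj-sym (Dist-T-edge e y)) dy ⟩
              _                                          ∎)
              where open ≡-Reasoning

  ends-resolved-by-other : ∀ {S} → Resolving T S → ∀ e → ∃[ t ] (t ∈ S × t ≢ n ↑ʳ e)
  ends-resolved-by-other {S} S-res e = other (S-res (end₁ e ↑ˡ m) (end₂ e ↑ˡ m) ends≢)
    where
      ends≢ : end₁ e ↑ˡ m ≢ end₂ e ↑ˡ m
      ends≢ eq = loopless e (↑ˡ-injective m _ _ eq)

      one-step : ∀ {x} → Incident G x e → Dist T (x ↑ˡ m) (n ↑ʳ e) 1
      one-step {x} i = subst (Dist T (x ↑ˡ m) (n ↑ʳ e)) (cong suc (dist-edge-incident i))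
                             (Dist-sym TAdj-sym (Dist-T-edge e x))

      other : Resolves T S (end₁ e ↑ˡ m) (end₂ e ↑ˡ m) → ∃[ t ] (t ∈ S × t ≢ n ↑ʳ e)
      other (t , t∈S , _ , _ , d₁ , d₂ , d₁≢d₂) = t , t∈S , λ { refl →
        d₁≢d₂ (trans (Dist-unique d₁ (one-step (inj₁ refl))) (Dist-unique (one-step (inj₂ refl)) d₂)) }

  anchored-at-end : ∀ {S} → Joins e c a → Closer a c (end₁ f) → n ↑ʳ e ∈ S → n ↑ʳ f ∈ S → e ≢ f →
                    Rooted.Anchored a S
  anchored-at-end {e} {c} {a} {f} j c₁ e∈S f∈S e≢f {e'} e'∈S with e' ≟ᶠ e
  ... | yes refl with child≡c , parent≡a ← Rooted.orientation-unique a j (Closer-self (e , j)) =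
    child f , child∈image f∈S ,
    subst₂ (λ p c → Closer p c (child f)) (sym parent≡a) (sym child≡c)
      (edge-on-one-side (Joins-sym j) (≢-sym e≢f) (inj₁ refl) (Joins⇒Incident (Joins-child-parent f)) c₁)
    where open Rooted a
  ... | no e'≢e = child e , child∈image e∈S ,
    edge-on-one-side (Joins-sym (Joins-child-parent e')) (≢-sym e'≢e)
      (Joins⇒Incident (Joins-sym j)) (Joins⇒Incident (Joins-child-parent e)) (parent-closer e')
    where open Rooted a

  anchored-root : ∀ {S} → 0 < n → Resolving T S → ∃[ ρ ] Rooted.Anchored ρ S
  anchored-root {S} 0<n S-res with any? (λ x → x ↑ˡ m ∈? S)
  ... | yes (x , x∈S) = x , λ {e} _ → x , Rooted.vertex∈image x x∈S , Rooted.parent-closer x e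
  ... | no ∄vertex with any? (λ e → n ↑ʳ e ∈? S)
  ...   | no ∄edge       = fromℕ< 0<n , λ {e} e∈S → contradiction (e , e∈S) ∄edge
  ...   | yes (e , e∈S) with t , t∈S , t≢e ← ends-resolved-by-other S-res e = second (sumView n m t) t∈S t≢e
    where
      second : ∀ {t} → SumView n m t → t ∈ S → t ≢ n ↑ʳ e → ∃[ ρ ] Rooted.Anchored ρ S
      second (inˡ x) x∈S _   = contradiction (x , x∈S) ∄vertex
      second (inʳ f) f∈S f≢e with side (e , joins-ends e) (end₁ f)
      ... | inj₁ c₁ = end₁ e , anchored-at-end (Joins-sym (joins-ends e)) c₁ e∈S f∈S (λ { refl → f≢e refl })
      ... | inj₂ c₂ = end₂ e , anchored-at-end (joins-ends e) c₂ e∈S f∈S (λ { refl → f≢e refl })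

  projection-of-resolving : ∀ {S} → 0 < n → Resolving T S →
                            ∃[ S' ] (Resolving (toGraph G) S' × ∣ S' ∣ ≤ ∣ S ∣)
  projection-of-resolving {S} 0<n S-res with ρ , anchored ← anchored-root 0<n S-res =
    image S (Rooted.project ρ) , Rooted.projection-resolves ρ S S-res anchored , ∣image∣≤ S _

proposition4p4 : (G : SimpleGraph) → IsTree G → (d₁ d₂ : ℕ) →
    IsMetricDim (toGraph G) d₁ → IsMetricDim (totalGraph G) d₂ →
    d₁ ≤ d₂ × d₂ ≤ leaves G
proposition4p4 G (0<n , connected , acyclic) d₁ d₂ (_ , d₁-minimal) ((S , S-resolves , ∣S∣≡d₂) , d₂-minimal) =
  lower (projection-of-resolving 0<n S-resolves) , upper
  where
    open Tree G connected acyclic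

    lower : ∃[ S' ] (Resolving (toGraph G) S' × ∣ S' ∣ ≤ ∣ S ∣) → d₁ ≤ d₂
    lower (S' , S'-resolves , ∣S'∣≤∣S∣) =
      ≤-trans (d₁-minimal S' S'-resolves) (≤-trans ∣S'∣≤∣S∣ (≤-reflexive ∣S∣≡d₂))

    upper : d₂ ≤ leaves G
    upper = ≤-trans (d₂-minimal leaf-set leaf-set-resolves) ∣leaf-set∣≤leaves
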